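{- Let $k\ge 3$, let $m$ be a positive integer divisible by $k-1$, let $l=\binom{m-1}{k-2}$, and let $B_1,\dots,B_l$ be a partition of $\binom{[m]}{k-1}$ into $l$ classes, each class $B_r$ consisting of $m/(k-1)$ pairwise disjoint $(k-1)$-subsets of $[m]$ (a 1-factorization). Let $V_m=\{v_{ij}: 1\le i\le l+1,\ 1\le j\le m\}$ ($(l+1)m$ distinct vertices) and let $\mathcal{E}_m$ be the set of all $k$-sets $\{v_{ij},v_{rs_1},v_{rs_2},\dots,v_{rs_{k-1}}\}$ with $1\le j\le m$, $1\le i\le l$, $i<r\le l+1$ and $\{s_1,\dots,s_{k-1}\}\in B_i$. Then $\mathcal{H}_m=(V_m,\mathcal{E}_m)$ is a $k$-uniform 2-hypertree which is an edge-minimal hypertree.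
   Context: A $k$-uniform hypergraph (finite vertex set, edges are $k$-subsets, no multiple edges) is a chain if there is a sequence $v_1,\dots,v_l$ of its vertices in which every vertex appears at least once (possibly more times), $v_1\ne v_l$, and its edge set consists of exactly the $l-k+1$ distinct sets $\{v_i,\dots,v_{i+k-1}\}$, $1\le i\le l-k+1$; it is a semicycle if the same holds with $v_1=v_l$ instead. Length = number of edges. Chain-connected: every pair of distinct vertices is contained in some subhypergraph that is a chain; semicycle-free: no subhypergraph is a semicycle. A hypertree is a chain-connected, semicycle-free $k$-uniform hypergraph; a 2-hypertree is a hypertree in which every chain (subhypergraph) has length at most 2. An edge-minimal hypertree is a hypertree $(V,\mathcal{E})$ such that for every $e\in\mathcal{E}$, $(V,\mathcal{E}\setminus\{e\})$ is not a hypertree. -}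

module Defs where

open import Data.Nat using (ℕ; zero; suc; _≤_; _<_; _∸_; _*_; _≤?_)
open import Data.Nat.Combinatorics using (_C_)
open import Data.Fin using (Fin; inject₁; combine) renaming (_<_ to _<ᶠ_)
open import Data.Fin.Subset using (Subset; ⊥; ⁅_⁆; _∪_; _∈_; ∣_∣)
open import Data.List using (List; []; _∷_; length; take; head; last; foldr)
open import Data.List.Relation.Unary.All using (All)
open import Data.List.Relation.Unary.AllPairs using (AllPairs)
open import Data.List.Relation.Unary.Unique.Propositional using (Unique)
import Data.List.Membership.Propositional as LMem
open import Data.Product using (Σ; ∃; ∃-syntax; _×_)
open import Data.Sum using (_⊎_)
open import Data.Empty renaming (⊥ to Empty)
open import Relation.Nullary using (¬_; yes; no)
open import Relation.Binary.PropositionalEquality using (_≡_; _≢_)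
open import Function.Bundles using (_⇔_)

-- A hypergraph on the vertex set Fin n is given by its edge predicate:
-- H e holds iff the subset e of Fin n is an edge.  (No multiple edges.)

Hypergraph : ℕ → Set₁
Hypergraph n = Subset n → Set

Uniform : ∀ {n} → ℕ → Hypergraph n → Set
Uniform k H = ∀ e → H e → ∣ e ∣ ≡ k

toSubset : ∀ {n} → List (Fin n) → Subset n
toSubset = foldr (λ x s → ⁅ x ⁆ ∪ s) ⊥

windows : ∀ {A : Set} → ℕ → List A → List (List A)
windows k [] = []
windows k (x ∷ xs) with k ≤? length (x ∷ xs)
... | yes _ = take k (x ∷ xs) ∷ windows k xs
... | no _  = []

-- A sequence vs = v₁ … v_l whose windows are l-k+1 (≥ 1) pairwise distinct
-- k-sets which are all edges of H.  Its vertex set is the set of entries of vs,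
-- its edge set the set of windows; such a sequence describes exactly a
-- sub-hypergraph of H which is a chain (v₁ ≢ v_l) or semicycle (v₁ ≡ v_l).
record WindowSeq {n} (k : ℕ) (H : Hypergraph n) (vs : List (Fin n)) : Set where
  field
    long     : k ≤ length vs
    kSets    : All Unique (windows k vs)
    distinct : AllPairs (λ w w′ → toSubset w ≢ toSubset w′) (windows k vs)
    inH      : All (λ w → H (toSubset w)) (windows k vs)

IsChain : ∀ {n} → ℕ → Hypergraph n → List (Fin n) → Set
IsChain k H vs = WindowSeq k H vs × head vs ≢ last vs

IsSemicycle : ∀ {n} → ℕ → Hypergraph n → List (Fin n) → Set
IsSemicycle k H vs = WindowSeq k H vs × head vs ≡ last vs

seqLength : ∀ {A : Set} → ℕ → List A → ℕ
seqLength k vs = length (windows k vs)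

ChainConnected : ∀ {n} → ℕ → Hypergraph n → Set
ChainConnected {n} k H =
  (u v : Fin n) → u ≢ v →
  ∃[ vs ] (IsChain k H vs × u LMem.∈ vs × v LMem.∈ vs)

SemicycleFree : ∀ {n} → ℕ → Hypergraph n → Set
SemicycleFree k H = ∀ vs → ¬ IsSemicycle k H vs

IsHypertree : ∀ {n} → ℕ → Hypergraph n → Set
IsHypertree k H = Uniform k H × ChainConnected k H × SemicycleFree k H

Is2Hypertree : ∀ {n} → ℕ → Hypergraph n → Set
Is2Hypertree k H = IsHypertree k H × (∀ vs → IsChain k H vs → seqLength k vs ≤ 2)

removeEdge : ∀ {n} → Hypergraph n → Subset n → Hypergraph n
removeEdge H e f = H f × f ≢ e

IsEdgeMinimalHypertree : ∀ {n} → ℕ → Hypergraph n → Set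
IsEdgeMinimalHypertree k H =
  IsHypertree k H × (∀ e → H e → ¬ IsHypertree k (removeEdge H e))

ℓ : ℕ → ℕ → ℕ
ℓ k m = (m ∸ 1) C (k ∸ 2)

-- A 1-factorization of the (k-1)-subsets of [m] = Fin m into ℓ k m classes,
-- class r consisting of the q sets B r 0, …, B r (q-1)  (q = m/(k-1)).
record OneFactorization (k m q : ℕ) (B : Fin (ℓ k m) → Fin q → Subset m) : Set where
  field
    size     : ∀ r c → ∣ B r c ∣ ≡ k ∸ 1
    disjoint : ∀ r c c′ → c ≢ c′ → ∀ x → x ∈ B r c → x ∈ B r c′ → Empty
    cover    : ∀ S → ∣ S ∣ ≡ k ∸ 1 → ∃[ r ] ∃[ c ] (B r c ≡ S)
    unique   : ∀ r c r′ c′ → B r c ≡ B r′ c′ → r ≡ r′ × c ≡ c′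

-- vertex v_{ij}, 1 ≤ i ≤ l+1, 1 ≤ j ≤ m, as an element of Fin ((l+1)·m)
vtx : ∀ {l m} → Fin (suc l) → Fin m → Fin (suc l * m)
vtx i j = combine i j

Hm : (k m q : ℕ) → (Fin (ℓ k m) → Fin q → Subset m) → Hypergraph (suc (ℓ k m) * m)
Hm k m q B e =
  ∃[ i ] ∃[ j ] ∃[ r ] ∃[ c ]
    (inject₁ i <ᶠ r ×
     (∀ x → (x ∈ e) ⇔ (x ≡ vtx {ℓ k m} (inject₁ i) j ⊎ ∃[ s ] (s ∈ B i c × x ≡ vtx {ℓ k m} r s))))

module Submission where

-- Write d = k - 1 ≥ 2.  An edge {v_ij} ∪ {v_rs : s ∈ B i c} consists of its apex v_ij in row i
-- and its block of d vertices in a lower row r > i.  Of two vertices of an edge in different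
-- rows the upper one is the apex; hence an edge is determined by its apex and one block vertex
-- (edgeThrough), and two distinct edges meeting in two vertices do not share an apex
-- (apex-unshared).  Consecutive windows of a vertex sequence share d ≥ 2 vertices and a
-- middle window lies in the union of its neighbours, so its apex would be shared: window
-- sequences of edges have at most two windows (noLongSeq).  Explicit forms of such short
-- sequences (ShortSeq) give "every chain has length ≤ 2" and "no semicycles".  Two distinct
-- consecutive windows have the same block (Overlap.sameBase), so after removing an edge its
-- apex and its block vertices lie in no common chain (separated): edge-minimality.
-- Chain-connectivity uses m = q·d: each class B i covers [m] (disjointCover), and any two
-- columns lie in a common block (extend, then the covering property of B).

open import Defs
open import Data.Nat using (ℕ; _≤_; _<_; _∸_; _*_)
open import Data.Fin using (Fin)
open import Data.Fin.Subset using (Subset)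
open import Data.Product using (_×_)
open import Relation.Binary.PropositionalEquality using (_≡_)

open import Data.Nat using (zero; suc; _+_; z≤n; s≤s; _≤?_) renaming (_≟_ to _≟ℕ_)
open import Data.Nat.Properties
  using ( module ≤-Reasoning; +-comm; +-suc; +-identityʳ; suc-injective
        ; ≤-refl; ≤-trans; ≤-reflexive; ≤-antisym; ≤∧≢⇒<; n≤1+n; m≤m+n; n≮n; ≰⇒>)
open import Data.Fin using (zero; suc; inject₁; remQuot; fromℕ; toℕ) renaming (_<_ to _<ᶠ_)
open import Data.Fin.Properties
  using ( combine-injective; combine-remQuot; inject₁-injective; <⇒≢; toℕ<n; inject₁ℕ<
        ; toℕ-fromℕ; ≤fromℕ; <-cmp; ¬∀⟶∃¬; any?)
  renaming (_≟_ to _≟ᶠ_; <-asym to <ᶠ-asym)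
open import Data.Fin.Relation.Unary.Top using (view; ‵fromℕ; ‵inject₁)
open import Data.Fin.Subset using (⊤; ⁅_⁆; _∪_; _∈_; _∉_; _⊆_; ∣_∣; inside; outside)
open import Data.Fin.Subset.Properties
  using ( _∈?_; ∉⊥; ∈⊤; x∈⁅x⁆; x∈⁅y⁆⇒x≡y; x∈p∪q⁺; x∈p∪q⁻; q⊆p∪q; ⊆-antisym; ∪-identityˡ
        ; p⊆q⇒∣p∣≤∣q∣; p⊂q⇒∣p∣<∣q∣; ∣⊤∣≡n; ∣⊥∣≡0; ∣⁅x⁆∣≡1)
open import Data.Vec using (_∷_; here; there)
open import Data.List using (List; []; _∷_; _++_; _∷ʳ_; length; map; filter; take; head; last; allFin)
open import Data.List.Base using (initLast; _∷ʳ′_)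
open import Data.List.Properties using (length-map; length-++; length-tabulate; take-all)
open import Data.List.Relation.Unary.All as All using (All; []; _∷_)
open import Data.List.Relation.Unary.AllPairs using (AllPairs; []; _∷_)
open import Data.List.Relation.Unary.Any using (here; there)
open import Data.List.Relation.Unary.Unique.Propositional using (Unique)
open import Data.List.Relation.Unary.Unique.Propositional.Properties using (filter⁺; allFin⁺; map⁺; ++⁺)
open import Data.List.Membership.Propositional using () renaming (_∈_ to _∈ₗ_; _∉_ to _∉ₗ_)
open import Data.List.Membership.Propositional.Properties
  using (∈-filter⁺; ∈-filter⁻; ∈-allFin; ∈-map⁺; ∈-map⁻; ∈-++⁺ˡ; ∈-++⁺ʳ; ∈-++⁻)
open import Data.List.Relation.Binary.Subset.Propositional using () renaming (_⊆_ to _⊆ₗ_)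
open import Data.Maybe using (just)
open import Data.Maybe.Properties using (just-injective)
open import Data.Product using (∃; ∃₂; ∃-syntax; _,_; proj₁; proj₂)
open import Data.Sum using (_⊎_; inj₁; inj₂)
open import Data.Empty renaming (⊥ to Empty) using (⊥-elim)
open import Function using (_∘_; id)
open import Function.Bundles using (_⇔_; mk⇔; Equivalence)
open import Relation.Nullary using (¬_; yes; no; contradiction)
open import Relation.Binary.Definitions using (tri<; tri≈; tri>)
open import Relation.Binary.PropositionalEquality
  using (_≢_; module ≡-Reasoning; refl; sym; trans; cong; cong₂; subst; subst₂; ≢-sym)

open Equivalence using (to; from)

∈-toSubset⁺ : ∀ {n} {xs : List (Fin n)} {x} → x ∈ₗ xs → x ∈ toSubset xs
∈-toSubset⁺ {x = x} (here refl) = x∈p∪q⁺ (inj₁ (x∈⁅x⁆ x))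
∈-toSubset⁺ (there x∈xs)        = x∈p∪q⁺ (inj₂ (∈-toSubset⁺ x∈xs))

∈-toSubset⁻ : ∀ {n} {xs : List (Fin n)} {x} → x ∈ toSubset xs → x ∈ₗ xs
∈-toSubset⁻ {xs = []}     x∈ = ⊥-elim (∉⊥ x∈)
∈-toSubset⁻ {xs = y ∷ ys} x∈ with x∈p∪q⁻ ⁅ y ⁆ (toSubset ys) x∈
... | inj₁ x∈y  = here (x∈⁅y⁆⇒x≡y y x∈y)
... | inj₂ x∈ys = there (∈-toSubset⁻ x∈ys)

∣⁅x⁆∪p∣ : ∀ {n} {x : Fin n} {p : Subset n} → x ∉ p → ∣ ⁅ x ⁆ ∪ p ∣ ≡ suc ∣ p ∣
∣⁅x⁆∪p∣ {x = zero}  {outside ∷ p} _   = cong (suc ∘ ∣_∣) (∪-identityˡ p)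
∣⁅x⁆∪p∣ {x = zero}  {inside  ∷ p} x∉p = ⊥-elim (x∉p here)
∣⁅x⁆∪p∣ {x = suc x} {outside ∷ p} x∉p = ∣⁅x⁆∪p∣ (x∉p ∘ there)
∣⁅x⁆∪p∣ {x = suc x} {inside  ∷ p} x∉p = cong suc (∣⁅x⁆∪p∣ (x∉p ∘ there))

∣toSubset∣ : ∀ {n} {xs : List (Fin n)} → Unique xs → ∣ toSubset xs ∣ ≡ length xs
∣toSubset∣ {n} {[]}     []         = ∣⊥∣≡0 n
∣toSubset∣ {xs = x ∷ xs} (x∉ ∷ uxs) =
  trans (∣⁅x⁆∪p∣ (λ x∈ → All.lookup x∉ (∈-toSubset⁻ x∈) refl)) (cong suc (∣toSubset∣ uxs))

elements : ∀ {n} → Subset n → List (Fin n)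
elements {n} p = filter (_∈? p) (allFin n)

∈-elements⁺ : ∀ {n} {p : Subset n} {x} → x ∈ p → x ∈ₗ elements p
∈-elements⁺ {p = p} {x} x∈p = ∈-filter⁺ (_∈? p) (∈-allFin x) x∈p

∈-elements⁻ : ∀ {n} {p : Subset n} {x} → x ∈ₗ elements p → x ∈ p
∈-elements⁻ {n} {p} x∈ = proj₂ (∈-filter⁻ (_∈? p) {xs = allFin n} x∈)

elements-unique : ∀ {n} (p : Subset n) → Unique (elements p)
elements-unique {n} p = filter⁺ (_∈? p) (allFin⁺ n)

length-elements : ∀ {n} (p : Subset n) → length (elements p) ≡ ∣ p ∣
length-elements p = trans (sym (∣toSubset∣ (elements-unique p))) (cong ∣_∣ toSubset-elements)
  where
  toSubset-elements : toSubset (elements p) ≡ p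
  toSubset-elements = ⊆-antisym (∈-elements⁻ ∘ ∈-toSubset⁻) (∈-toSubset⁺ ∘ ∈-elements⁺)

saturate : ∀ {n} {xs ys : List (Fin n)} → Unique xs → Unique ys → xs ⊆ₗ ys →
           length ys ≤ length xs → ys ⊆ₗ xs
saturate {xs = xs} {ys} uxs uys xs⊆ys ys≤xs {y} y∈ys with y ∈? toSubset xs
... | yes y∈xs = ∈-toSubset⁻ y∈xs
... | no  y∉xs = ⊥-elim (n≮n (length xs) (≤-trans xs<ys ys≤xs))
  where
  xs<ys : length xs < length ys
  xs<ys = subst₂ _<_ (∣toSubset∣ uxs) (∣toSubset∣ uys)
            (p⊂q⇒∣p∣<∣q∣ ((∈-toSubset⁺ ∘ xs⊆ys ∘ ∈-toSubset⁻) , y , ∈-toSubset⁺ y∈ys , y∉xs))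

extend : ∀ {n} t {p : Subset n} → ∣ p ∣ + t ≤ n → ∃[ p′ ] (p ⊆ p′ × ∣ p′ ∣ ≡ ∣ p ∣ + t)
extend zero    {p} _  = p , id , sym (+-identityʳ ∣ p ∣)
extend {n} (suc t) {p} room = enlarge (¬∀⟶∃¬ n (_∈ p) (_∈? p) p≢⊤)
  where
  open ≤-Reasoning
  p<n : ∣ p ∣ < n
  p<n = begin-strict
    ∣ p ∣           <⟨ s≤s (m≤m+n ∣ p ∣ t) ⟩
    suc ∣ p ∣ + t   ≡⟨ sym (+-suc ∣ p ∣ t) ⟩
    ∣ p ∣ + suc t   ≤⟨ room ⟩
    n               ∎
  p≢⊤ : ¬ (∀ x → x ∈ p)
  p≢⊤ all = n≮n n (begin-strict
    n         ≡⟨ sym (∣⊤∣≡n n) ⟩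
    ∣ ⊤ {n} ∣ ≤⟨ p⊆q⇒∣p∣≤∣q∣ {p = ⊤} {q = p} (λ {x} _ → all x) ⟩
    ∣ p ∣     <⟨ p<n ⟩
    n         ∎)
  grow : ∀ {x} → x ∉ p → ∣ ⁅ x ⁆ ∪ p ∣ + t ≡ ∣ p ∣ + suc t
  grow x∉p = trans (cong (_+ t) (∣⁅x⁆∪p∣ x∉p)) (sym (+-suc ∣ p ∣ t))
  enlarge : ∃[ x ] x ∉ p → ∃[ p′ ] (p ⊆ p′ × ∣ p′ ∣ ≡ ∣ p ∣ + suc t)
  enlarge (x , x∉p) with extend t {⁅ x ⁆ ∪ p} (subst (_≤ n) (sym (grow x∉p)) room)
  ... | p′ , ⊆p′ , size = p′ , ⊆p′ ∘ q⊆p∪q ⁅ x ⁆ p , trans size (grow x∉p)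

disjointCover : ∀ {m q d} (S : Fin q → Subset m) → (∀ c → ∣ S c ∣ ≡ d) →
                (∀ c c′ → c ≢ c′ → ∀ x → x ∈ S c → x ∈ S c′ → Empty) →
                m ≡ q * d → ∀ x → ∃[ c ] (x ∈ S c)
disjointCover {m} {q} {d} S size disjoint m≡qd x with any? (λ c → x ∈? S c)
... | yes covered   = covered
... | no  uncovered = ⊥-elim (n≮n m (begin-strict
    m                                ≡⟨ m≡qd ⟩
    q * d                            ≡⟨ sym (cong (_* d) (length-tabulate {n = q} id)) ⟩
    length (allFin q) * d            ≡⟨ sym (length-union (allFin q)) ⟩
    length (union (allFin q))        ≡⟨ sym (∣toSubset∣ (union-unique (allFin⁺ q))) ⟩
    ∣ toSubset (union (allFin q)) ∣  <⟨ p⊂q⇒∣p∣<∣q∣ ((λ _ → ∈⊤) , x , ∈⊤ , x∉union) ⟩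
    ∣ ⊤ {m} ∣                        ≡⟨ ∣⊤∣≡n m ⟩
    m                                ∎))
  where
  open ≤-Reasoning
  -- The concatenated element lists of the sets S c, c ∈ cs; it is duplicate-free, and if it
  -- missed x its vertex set would be a proper subset of Fin m of size q·d = m.
  union : List (Fin q) → List (Fin m)
  union []       = []
  union (c ∷ cs) = elements (S c) ++ union cs

  length-union : ∀ cs → length (union cs) ≡ length cs * d
  length-union []       = refl
  length-union (c ∷ cs) =
    trans (length-++ (elements (S c))) (cong₂ _+_ (trans (length-elements (S c)) (size c)) (length-union cs))

  ∈-union : ∀ cs {y} → y ∈ₗ union cs → ∃[ c ] (c ∈ₗ cs × y ∈ S c)
  ∈-union (c ∷ cs) y∈ with ∈-++⁻ (elements (S c)) y∈
  ... | inj₁ y∈c  = c , here refl , ∈-elements⁻ y∈c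
  ... | inj₂ y∈cs = let c′ , c′∈cs , y∈c′ = ∈-union cs y∈cs in c′ , there c′∈cs , y∈c′

  union-unique : ∀ {cs} → Unique cs → Unique (union cs)
  union-unique {[]}     []           = []
  union-unique {c ∷ cs} (c∉cs ∷ ucs) = ++⁺ (elements-unique (S c)) (union-unique ucs) apart
    where
    apart : ∀ {y} → ¬ (y ∈ₗ elements (S c) × y ∈ₗ union cs)
    apart (y∈c , y∈cs) = let c′ , c′∈cs , y∈c′ = ∈-union cs y∈cs
                         in disjoint c c′ (All.lookup c∉cs c′∈cs) _ (∈-elements⁻ y∈c) y∈c′

  x∉union : x ∉ toSubset (union (allFin q))
  x∉union x∈ = let c , _ , x∈c = ∈-union (allFin q) (∈-toSubset⁻ x∈) in uncovered (c , x∈c)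

module _ {A : Set} where

  take-prefix : ∀ (xs ys : List A) → take (length xs) (xs ++ ys) ≡ xs
  take-prefix []       ys = refl
  take-prefix (x ∷ xs) ys = cong (x ∷_) (take-prefix xs ys)

  ∈-take-suc : ∀ t {xs : List A} {x} → x ∈ₗ take t xs → x ∈ₗ take (suc t) xs
  ∈-take-suc (suc t) {y ∷ ys} (here x≡y) = here x≡y
  ∈-take-suc (suc t) {y ∷ ys} (there x∈) = there (∈-take-suc t x∈)

  length-∷ʳ : ∀ (xs : List A) y → length (xs ∷ʳ y) ≡ suc (length xs)
  length-∷ʳ xs y = trans (length-++ xs) (+-comm (length xs) 1)

  last-∷ʳ : ∀ (xs : List A) y → last (xs ∷ʳ y) ≡ just y
  last-∷ʳ []           y = refl
  last-∷ʳ (x ∷ [])     y = refl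
  last-∷ʳ (x ∷ x′ ∷ xs) y = last-∷ʳ (x′ ∷ xs) y

  ends-distinct : ∀ {vs : List A} → Unique vs → 2 ≤ length vs → head vs ≢ last vs
  ends-distinct {x ∷ zs} (x∉zs ∷ _) two with initLast zs
  ends-distinct {x ∷ _} (x∉zs ∷ _) (s≤s ()) | []
  ... | ws ∷ʳ′ y = λ x≡y →
    All.lookup x∉zs (∈-++⁺ʳ ws (here refl)) (just-injective (trans x≡y (last-∷ʳ (x ∷ ws) y)))

module _ {A : Set} where

  windows-cons : ∀ k (x : A) xs → k ≤ length (x ∷ xs) → windows k (x ∷ xs) ≡ take k (x ∷ xs) ∷ windows k xs
  windows-cons k x xs fits with k ≤? length (x ∷ xs)
  ... | yes _      = refl
  ... | no  ¬fits  = contradiction fits ¬fits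

  windows-short : ∀ k (xs : List A) → length xs < k → windows k xs ≡ []
  windows-short k []       _     = refl
  windows-short k (x ∷ xs) short with k ≤? length (x ∷ xs)
  ... | yes fits = ⊥-elim (n≮n (length (x ∷ xs)) (≤-trans short fits))
  ... | no  _    = refl

  windows-single : ∀ d (vs : List A) → length vs ≡ suc d → windows (suc d) vs ≡ vs ∷ []
  windows-single d (v ∷ vs) len = trans (windows-cons (suc d) v vs (≤-reflexive (sym len)))
    (cong₂ _∷_ (take-all (suc d) (v ∷ vs) (≤-reflexive len)) (windows-short (suc d) vs (≤-reflexive len)))

  windows-double : ∀ d (x : A) ws y → length ws ≡ d →
                   windows (suc d) (x ∷ ws ∷ʳ y) ≡ (x ∷ ws) ∷ (ws ∷ʳ y) ∷ []
  windows-double d x ws y refl =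
    trans (windows-cons (suc d) x (ws ∷ʳ y) (≤-trans (n≤1+n _) (≤-reflexive (sym len))))
      (cong₂ _∷_ (cong (x ∷_) (take-prefix ws (y ∷ []))) (windows-single d (ws ∷ʳ y) (length-∷ʳ ws y)))
    where len = cong suc (length-∷ʳ ws y)

  windows-triple : ∀ k (a b c : A) zs → suc (suc k) ≤ length (a ∷ b ∷ c ∷ zs) →
    windows k (a ∷ b ∷ c ∷ zs) ≡
      take k (a ∷ b ∷ c ∷ zs) ∷ take k (b ∷ c ∷ zs) ∷ take k (c ∷ zs) ∷ windows k zs
  windows-triple k a b c zs (s≤s (s≤s fits)) =
    trans (windows-cons k a _ (≤-trans fits (≤-trans (n≤1+n _) (n≤1+n _))))
      (cong (take k (a ∷ b ∷ c ∷ zs) ∷_) (trans (windows-cons k b _ (≤-trans fits (n≤1+n _)))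
        (cong (take k (b ∷ c ∷ zs) ∷_) (windows-cons k c _ fits))))

  windows-length-cons : ∀ k (x : A) xs → length (windows k (x ∷ xs)) ≤ suc (length (windows k xs))
  windows-length-cons k x xs with k ≤? length (x ∷ xs)
  ... | yes _ = ≤-refl
  ... | no  _ = z≤n

  fewWindows : ∀ k (vs : List A) → length vs ≤ suc k → length (windows k vs) ≤ 2
  fewWindows k []           _ = z≤n
  fewWindows k (x ∷ [])     _ = ≤-trans (windows-length-cons k x []) (s≤s z≤n)
  fewWindows k (x ∷ y ∷ ys) (s≤s short) =
    ≤-trans (windows-length-cons k x (y ∷ ys)) (s≤s (≤-trans (windows-length-cons k y ys)
      (s≤s (≤-reflexive (cong length (windows-short k ys short))))))

Apart : ∀ {n} → List (Fin n) → List (Fin n) → Set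
Apart w w′ = toSubset w ≢ toSubset w′

windowData : ∀ {n k} {H : Hypergraph n} {vs wss} → WindowSeq k H vs → windows k vs ≡ wss →
             All Unique wss × AllPairs Apart wss × All (H ∘ toSubset) wss
windowData seq refl = kSets , distinct , inH where open WindowSeq seq

mkWindowSeq : ∀ {n k} {H : Hypergraph n} {vs wss} → windows k vs ≡ wss → k ≤ length vs →
              All Unique wss → AllPairs Apart wss → All (H ∘ toSubset) wss → WindowSeq k H vs
mkWindowSeq refl long kSets distinct inH =
  record { long = long ; kSets = kSets ; distinct = distinct ; inH = inH }

data ShortSeq {n} (d : ℕ) (H : Hypergraph n) : List (Fin n) → Set where
  single : ∀ {vs} → length vs ≡ suc d → Unique vs → H (toSubset vs) → ShortSeq d H vs
  double : ∀ {x ws y} → length ws ≡ d → Unique (x ∷ ws) → Unique (ws ∷ʳ y) →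
           H (toSubset (x ∷ ws)) → H (toSubset (ws ∷ʳ y)) → Apart (x ∷ ws) (ws ∷ʳ y) →
           ShortSeq d H (x ∷ ws ∷ʳ y)

toShort : ∀ {n d} {H : Hypergraph n} {vs} → WindowSeq (suc d) H vs → length vs ≤ suc (suc d) →
          ShortSeq d H vs
toShort {d = d} {vs = vs} seq short with suc d ≟ℕ length vs
... | yes len with windowData seq (windows-single d vs (sym len))
...   | u ∷ [] , _ , h ∷ [] = single (sym len) u h
toShort {d = d} {vs = vs} seq short | no len≢ =
  toDouble vs (≤-antisym short (≤∧≢⇒< (WindowSeq.long seq) len≢)) seq
  where
  twoWindows : ∀ {H x ws y} → length ws ≡ d → WindowSeq (suc d) H (x ∷ ws ∷ʳ y) → ShortSeq d H (x ∷ ws ∷ʳ y)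
  twoWindows {x = x} {ws} {y} ws-len seq with windowData seq (windows-double d x ws y ws-len)
  ... | u₁ ∷ u₂ ∷ [] , (a ∷ []) ∷ [] ∷ [] , h₁ ∷ h₂ ∷ [] = double ws-len u₁ u₂ h₁ h₂ a

  toDouble : ∀ {H} vs → length vs ≡ suc (suc d) → WindowSeq (suc d) H vs → ShortSeq d H vs
  toDouble (x ∷ zs) len seq with initLast zs
  toDouble (x ∷ _) () seq | []
  ... | ws ∷ʳ′ y = twoWindows (suc-injective (trans (sym (length-∷ʳ ws y)) (suc-injective len))) seq

fromShort : ∀ {n d} {H : Hypergraph n} {vs} → ShortSeq d H vs → WindowSeq (suc d) H vs
fromShort (single len u h) =
  mkWindowSeq (windows-single _ _ len) (≤-reflexive (sym len)) (u ∷ []) ([] ∷ []) (h ∷ [])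
fromShort {d = d} (double {x} {ws} {y} len u₁ u₂ h₁ h₂ a) =
  mkWindowSeq (windows-double d x ws y len) (≤-trans (n≤1+n _) (≤-reflexive (sym fits)))
              (u₁ ∷ u₂ ∷ []) ((a ∷ []) ∷ [] ∷ []) (h₁ ∷ h₂ ∷ [])
  where
  fits : length (x ∷ ws ∷ʳ y) ≡ suc (suc d)
  fits = cong suc (trans (length-∷ʳ ws y) (cong suc len))

-- A short window sequence with windows of size ≥ 2 is never closed: a single window has no
-- repeated vertex, and closing two windows x ∷ ws, ws ∷ʳ x would make them equal as sets.
shortSeq-open : ∀ {n d} {H : Hypergraph n} {vs} → ShortSeq (suc d) H vs → head vs ≢ last vs
shortSeq-open (single len u _) = ends-distinct u (≤-trans (s≤s (s≤s z≤n)) (≤-reflexive (sym len)))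
shortSeq-open (double {x} {ws} {y} _ _ _ _ _ apart) closed =
  apart (⊆-antisym (∈-toSubset⁺ ∘ forth ∘ ∈-toSubset⁻) (∈-toSubset⁺ ∘ back ∘ ∈-toSubset⁻))
  where
  x≡y : x ≡ y
  x≡y = just-injective (trans closed (last-∷ʳ (x ∷ ws) y))
  forth : x ∷ ws ⊆ₗ ws ∷ʳ y
  forth (here refl)  = ∈-++⁺ʳ ws (here x≡y)
  forth (there z∈ws) = ∈-++⁺ˡ z∈ws
  back : ws ∷ʳ y ⊆ₗ x ∷ ws
  back z∈ with ∈-++⁻ ws z∈
  ... | inj₁ z∈ws        = there z∈ws
  ... | inj₂ (here refl) = here (sym x≡y)

module Construction (k′ m q : ℕ) (B : Fin (ℓ (3 + k′) m) → Fin q → Subset m)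
                    (F : OneFactorization (3 + k′) m q B) where

  open OneFactorization F

  d k l N : ℕ
  d = 2 + k′
  k = suc d
  l = ℓ k m
  N = suc l * m

  H : Hypergraph N
  H = Hm k m q B

  V : Fin (suc l) → Fin m → Fin N
  V = vtx {l}

  V-injective : ∀ a b a′ b′ → V a b ≡ V a′ b′ → a ≡ a′ × b ≡ b′
  V-injective = combine-injective

  sameRow : ∀ a b a′ b′ → V a b ≡ V a′ b′ → a ≡ a′
  sameRow a b a′ b′ = proj₁ ∘ V-injective a b a′ b′

  V-surjective : ∀ x → ∃₂ λ a b → x ≡ V a b
  V-surjective x = let a , b = remQuot {suc l} m x in a , b , sym (combine-remQuot {suc l} m x)

  InEdge : Fin l → Fin m → Fin (suc l) → Fin q → Fin N → Set
  InEdge i j r c x = x ≡ V (inject₁ i) j ⊎ ∃[ s ] (s ∈ B i c × x ≡ V r s)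

  block : Fin l → Fin (suc l) → Fin q → List (Fin N)
  block i r c = map (V r) (elements (B i c))

  edgeList : Fin l → Fin m → Fin (suc l) → Fin q → List (Fin N)
  edgeList i j r c = V (inject₁ i) j ∷ block i r c

  ∈-block⁺ : ∀ {i r c s} → s ∈ B i c → V r s ∈ₗ block i r c
  ∈-block⁺ {r = r} = ∈-map⁺ (V r) ∘ ∈-elements⁺

  ∈-block⁻ : ∀ {i r c x} → x ∈ₗ block i r c → ∃[ s ] (s ∈ B i c × x ≡ V r s)
  ∈-block⁻ {r = r} x∈ = let s , s∈ , x≡ = ∈-map⁻ (V r) x∈ in s , ∈-elements⁻ s∈ , x≡

  ∉-block : ∀ {i r c a b} → a ≢ r → V a b ∉ₗ block i r c
  ∉-block {i} {r} {c} {a} {b} a≢r x∈ = let s , _ , x≡ = ∈-block⁻ {i} {r} {c} x∈ in a≢r (sameRow a b r s x≡)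

  block-unique : ∀ i r c → Unique (block i r c)
  block-unique i r c = map⁺ (λ {s} {s′} → proj₂ ∘ V-injective r s r s′) (elements-unique (B i c))

  length-block : ∀ i r c → length (block i r c) ≡ d
  length-block i r c = trans (length-map (V r) (elements (B i c))) (trans (length-elements (B i c)) (size i c))

  B-inhabited : ∀ i c → ∃[ s ] (s ∈ B i c)
  B-inhabited i c = let s , s∈ = first (elements (B i c)) (trans (length-elements (B i c)) (size i c))
                    in s , ∈-elements⁻ s∈
    where
    first : ∀ xs → length xs ≡ d → ∃ (_∈ₗ xs)
    first (s ∷ _) _ = s , here refl

  sameEdge : ∀ {e e′ i j r c} → (∀ x → x ∈ e ⇔ InEdge i j r c x) → (∀ x → x ∈ e′ ⇔ InEdge i j r c x) →
             e ≡ e′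
  sameEdge mem mem′ =
    ⊆-antisym (λ {x} x∈ → from (mem′ x) (to (mem x) x∈)) (λ {x} x∈ → from (mem x) (to (mem′ x) x∈))

  listedEdge : ∀ {i j r c} L → inject₁ i <ᶠ r → (∀ {x} → x ∈ₗ L → InEdge i j r c x) →
               (∀ {x} → InEdge i j r c x → x ∈ₗ L) → H (toSubset L)
  listedEdge {i} {j} {r} {c} L lt ⊆ ⊇ = i , j , r , c , lt , λ x → mk⇔ (⊆ ∘ ∈-toSubset⁻) (∈-toSubset⁺ ∘ ⊇)

  ∈-edgeList⁻ : ∀ {i j r c x} → x ∈ₗ edgeList i j r c → InEdge i j r c x
  ∈-edgeList⁻ (here x≡)  = inj₁ x≡
  ∈-edgeList⁻ {i} {j} {r} {c} (there x∈) = inj₂ (∈-block⁻ {i} {r} {c} x∈)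

  ∈-edgeList⁺ : ∀ {i j r c x} → InEdge i j r c x → x ∈ₗ edgeList i j r c
  ∈-edgeList⁺ (inj₁ x≡)               = here x≡
  ∈-edgeList⁺ {r = r} (inj₂ (s , s∈ , refl)) = there (∈-block⁺ {r = r} s∈)

  edgeList-edge : ∀ {i j r c} → inject₁ i <ᶠ r → H (toSubset (edgeList i j r c))
  edgeList-edge {i} {j} {r} {c} lt =
    listedEdge (edgeList i j r c) lt (∈-edgeList⁻ {i} {j} {r} {c}) (∈-edgeList⁺ {i} {j} {r} {c})

  edgeList-unique : ∀ {i j r c} → inject₁ i <ᶠ r → Unique (edgeList i j r c)
  edgeList-unique {i} {j} {r} {c} lt =
    All.tabulate (λ x∈ apex≡x → ∉-block (<⇒≢ lt) (subst (_∈ₗ block i r c) (sym apex≡x) x∈)) ∷ block-unique i r c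

  uniform : Uniform k H
  uniform e (i , j , r , c , lt , mem) = begin
    ∣ e ∣                            ≡⟨ cong ∣_∣ (sameEdge {i = i} {j} {r} {c} mem spans) ⟩
    ∣ toSubset (edgeList i j r c) ∣  ≡⟨ ∣toSubset∣ (edgeList-unique lt) ⟩
    suc (length (block i r c))      ≡⟨ cong suc (length-block i r c) ⟩
    k                               ∎
    where
    open ≡-Reasoning
    spans : ∀ x → x ∈ toSubset (edgeList i j r c) ⇔ InEdge i j r c x
    spans x = mk⇔ (∈-edgeList⁻ {i} {j} {r} {c} ∘ ∈-toSubset⁻) (∈-toSubset⁺ ∘ ∈-edgeList⁺ {i} {j} {r} {c})

  apex : ∀ {e} → H e → Fin N
  apex (i , j , _) = V (inject₁ i) j

  apex∈ : ∀ {e} (h : H e) → apex h ∈ e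
  apex∈ (_ , _ , _ , _ , _ , mem) = from (mem _) (inj₁ refl)

  Oriented : ∀ {e} → H e → Fin (suc l) → Fin m → Fin (suc l) → Fin m → Set
  Oriented (i , j , r , c , _) a b a′ b′ = a ≡ inject₁ i × b ≡ j × a′ ≡ r × b′ ∈ B i c

  orient : ∀ {e} (h : H e) {a b a′ b′} → V a b ∈ e → V a′ b′ ∈ e → a <ᶠ a′ → Oriented h a b a′ b′
  orient (i , j , r , c , lt , mem) {a} {b} {a′} {b′} x∈ y∈ a<a′ with to (mem _) x∈ | to (mem _) y∈
  ... | inj₁ x≡ | inj₂ (s , s∈ , y≡) =
    let a≡ , b≡ = V-injective a b (inject₁ i) j x≡ ; a′≡ , b′≡ = V-injective a′ b′ r s y≡
    in a≡ , b≡ , a′≡ , subst (_∈ B i c) (sym b′≡) s∈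
  ... | inj₁ x≡ | inj₁ y≡ =
    ⊥-elim (<⇒≢ a<a′ (trans (sameRow a b (inject₁ i) j x≡) (sym (sameRow a′ b′ (inject₁ i) j y≡))))
  ... | inj₂ (s , _ , x≡) | inj₁ y≡ =
    ⊥-elim (<ᶠ-asym a<a′ (subst₂ _<ᶠ_ (sym (sameRow a′ b′ (inject₁ i) j y≡)) (sym (sameRow a b r s x≡)) lt))
  ... | inj₂ (s , _ , x≡) | inj₂ (t , _ , y≡) =
    ⊥-elim (<⇒≢ a<a′ (trans (sameRow a b r s x≡) (sym (sameRow a′ b′ r t y≡))))

  edgeThrough : ∀ {e e′ i j r c s} → inject₁ i <ᶠ r → (∀ x → x ∈ e ⇔ InEdge i j r c x) → s ∈ B i c →
                H e′ → V (inject₁ i) j ∈ e′ → V r s ∈ e′ → e′ ≡ e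
  edgeThrough {i = i} {j} {r} {c} {s} lt mem s∈ h′@(i′ , _ , _ , c′ , _ , mem′) u∈ v∈
    with orient h′ u∈ v∈ lt
  ... | i≡i′ , refl , refl , s∈′ with inject₁-injective i≡i′
  ... | refl with c ≟ᶠ c′
  ...   | yes refl  = sameEdge {i = i} {j} {r} {c} mem′ mem
  ...   | no  c≢c′  = ⊥-elim (disjoint i c c′ c≢c′ s s∈ s∈′)

  MeetTwice : Subset N → Subset N → Set
  MeetTwice e e′ = ∃₂ λ x y → x ≢ y × (x ∈ e × x ∈ e′) × (y ∈ e × y ∈ e′)

  -- If two distinct edges meet twice, the apex of either is not in the other: one common
  -- vertex lies in the block of the first edge, and together with its apex it would
  -- determine that edge.
  apex-unshared : ∀ {e e′} (h : H e) → H e′ → e ≢ e′ → MeetTwice e e′ → apex h ∉ e′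
  apex-unshared (i , j , r , c , lt , mem) h′ e≢e′ (x , y , x≢y , (x∈ , x∈′) , (y∈ , y∈′)) apex∈′
    with to (mem x) x∈ | to (mem y) y∈
  ... | inj₂ (s , s∈ , refl) | _                    = e≢e′ (sym (edgeThrough lt mem s∈ h′ apex∈′ x∈′))
  ... | inj₁ _               | inj₂ (s , s∈ , refl) = e≢e′ (sym (edgeThrough lt mem s∈ h′ apex∈′ y∈′))
  ... | inj₁ x≡              | inj₁ y≡              = x≢y (trans x≡ (sym y≡))

  -- No edge is covered by two other edges which both meet it twice: its apex would be shared.
  noMiddleEdge : ∀ {e₁ e₂ e₃} → H e₁ → H e₂ → H e₃ → e₂ ≢ e₁ → e₂ ≢ e₃ →
                 MeetTwice e₂ e₁ → MeetTwice e₂ e₃ → e₂ ⊆ (e₁ ∪ e₃) → Empty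
  noMiddleEdge {e₁} {e₂} {e₃} h₁ h₂ h₃ e₂≢e₁ e₂≢e₃ meet₁ meet₃ covered with x∈p∪q⁻ e₁ e₃ (covered (apex∈ h₂))
  ... | inj₁ apex∈e₁ = apex-unshared h₂ h₁ e₂≢e₁ meet₁ apex∈e₁
  ... | inj₂ apex∈e₃ = apex-unshared h₂ h₃ e₂≢e₃ meet₃ apex∈e₃

  -- Hence no window sequence of edges of H has three windows: consecutive windows share
  -- k - 1 ≥ 2 vertices, and the middle window lies in the union of its neighbours.
  noLongSeq : ∀ {H′ : Hypergraph N} → (∀ {e} → H′ e → H e) → ∀ {vs} → WindowSeq k H′ vs → length vs ≤ suc k
  noLongSeq {H′} sub {vs} seq with length vs ≤? suc k
  ... | yes short = short
  ... | no  long  = ⊥-elim (threeWindows vs seq (≰⇒> long))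
    where
    threeWindows : ∀ vs → WindowSeq k H′ vs → suc (suc k) ≤ length vs → Empty
    threeWindows (v₁ ∷ v₂ ∷ y₀ ∷ y₁ ∷ zs) seq long
      with windowData seq (windows-triple k v₁ v₂ y₀ (y₁ ∷ zs) long)
    ... | _ ∷ (v₂∉ ∷ y₀∉ ∷ _) ∷ _ , (w₁≢w₂ ∷ _) ∷ (w₂≢w₃ ∷ _) ∷ _ , h₁ ∷ h₂ ∷ h₃ ∷ _ =
      noMiddleEdge (sub h₁) (sub h₂) (sub h₃) (≢-sym w₁≢w₂) w₂≢w₃ meet₁ meet₃ (w₂⊆w₁∪w₃ ∘ ∈-toSubset⁻)
      where
      w₁ w₂ w₃ : List (Fin N)
      w₁ = v₁ ∷ v₂ ∷ y₀ ∷ take k′ (y₁ ∷ zs)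
      w₂ = v₂ ∷ y₀ ∷ y₁ ∷ take k′ zs
      w₃ = y₀ ∷ y₁ ∷ take (suc k′) zs
      at : ∀ w {x} → x ∈ₗ w → x ∈ toSubset w
      at w = ∈-toSubset⁺ {xs = w}
      meet₁ : MeetTwice (toSubset w₂) (toSubset w₁)
      meet₁ = v₂ , y₀ , All.head v₂∉ , (at w₂ (here refl) , at w₁ (there (here refl)))
                                     , (at w₂ (there (here refl)) , at w₁ (there (there (here refl))))
      meet₃ : MeetTwice (toSubset w₂) (toSubset w₃)
      meet₃ = y₀ , y₁ , All.head y₀∉ , (at w₂ (there (here refl)) , at w₃ (here refl))
                                     , (at w₂ (there (there (here refl))) , at w₃ (there (here refl)))
      w₂⊆w₁∪w₃ : ∀ {x} → x ∈ₗ w₂ → x ∈ toSubset w₁ ∪ toSubset w₃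
      w₂⊆w₁∪w₃ (here refl)                 = x∈p∪q⁺ (inj₁ (at w₁ (there (here refl))))
      w₂⊆w₁∪w₃ (there (here refl))         = x∈p∪q⁺ (inj₂ (at w₃ (here refl)))
      w₂⊆w₁∪w₃ (there (there (here refl))) = x∈p∪q⁺ (inj₂ (at w₃ (there (here refl))))
      w₂⊆w₁∪w₃ (there (there (there x∈)))  = x∈p∪q⁺ (inj₂ (at w₃ (there (there (∈-take-suc k′ x∈)))))
    threeWindows (_ ∷ [])           _ (s≤s ())
    threeWindows (_ ∷ _ ∷ [])       _ (s≤s (s≤s ()))
    threeWindows (_ ∷ _ ∷ _ ∷ [])   _ (s≤s (s≤s (s≤s ())))

  chainsShort : ∀ vs → IsChain k H vs → seqLength k vs ≤ 2
  chainsShort vs (seq , _) = fewWindows k vs (noLongSeq id seq)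

  semicycleFree : SemicycleFree k H
  semicycleFree vs (seq , closed) = shortSeq-open (toShort seq (noLongSeq id seq)) closed

  base : ∀ {e} → H e → Fin l × Fin (suc l) × Fin q
  base (i , _ , r , c , _) = i , r , c

  blockOf : ∀ {e} → H e → List (Fin N)
  blockOf (i , _ , r , c , _) = block i r c

  block-⊆ : ∀ {i r c i′ r′ c′} → block i r c ⊆ₗ block i′ r′ c′ → r ≡ r′ × B i c ⊆ B i′ c′
  block-⊆ {i} {r} {c} {i′} {r′} {c′} sub = proj₁ (lands (proj₂ (B-inhabited i c))) , proj₂ ∘ lands
    where
    lands : ∀ {s} → s ∈ B i c → r ≡ r′ × s ∈ B i′ c′
    lands {s} s∈ with ∈-block⁻ {i′} {r′} {c′} (sub (∈-block⁺ {r = r} s∈))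
    ... | t , t∈ , eq = let r≡r′ , s≡t = V-injective r s r′ t eq in r≡r′ , subst (_∈ B i′ c′) (sym s≡t) t∈

  -- Edges with the same base differ at most in their apexes, which lie in one row.
  crossPair : ∀ {e₁ e₂} (h₁ : H e₁) (h₂ : H e₂) → base h₁ ≡ base h₂ → ∀ {a b a′ b′} → a <ᶠ a′ →
              V a b ∈ e₁ → V a′ b′ ∈ e₂ → V a b ∈ e₂ ⊎ V a′ b′ ∈ e₁
  crossPair (i , j₁ , r , c , _ , mem₁) (_ , j₂ , _ , _ , _ , mem₂) refl {a} {b} {a′} {b′} a<a′ u∈ v∈
    with to (mem₁ _) u∈ | to (mem₂ _) v∈
  ... | inj₂ u-in-block | _              = inj₁ (from (mem₂ _) (inj₂ u-in-block))
  ... | inj₁ _          | inj₂ v-in-block = inj₂ (from (mem₁ _) (inj₂ v-in-block))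
  ... | inj₁ u≡         | inj₁ v≡         =
    ⊥-elim (<⇒≢ a<a′ (trans (sameRow a b (inject₁ i) j₁ u≡) (sym (sameRow a′ b′ (inject₁ i) j₂ v≡))))

  module Overlap {ws : List (Fin N)} (ws-unique : Unique ws) (ws-length : length ws ≡ d) where

    meetTwice : ∀ {e e′} → (∀ {x} → x ∈ₗ ws → x ∈ e) → (∀ {x} → x ∈ₗ ws → x ∈ e′) → MeetTwice e e′
    meetTwice = twoOf ws-unique ws-length
      where
      twoOf : ∀ {vs e e′} → Unique vs → length vs ≡ d →
              (∀ {x} → x ∈ₗ vs → x ∈ e) → (∀ {x} → x ∈ₗ vs → x ∈ e′) → MeetTwice e e′
      twoOf {x ∷ y ∷ _} (x∉ ∷ _) _ ⊆e ⊆e′ =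
        x , y , All.head x∉ , (⊆e (here refl) , ⊆e′ (here refl)) , (⊆e (there (here refl)) , ⊆e′ (there (here refl)))

    -- The shared vertices avoid the apex (it is unshared), so they fill the block of each edge.
    ws≈block : ∀ {e e′} (h : H e) → H e′ → e ≢ e′ → (∀ {x} → x ∈ₗ ws → x ∈ e) → (∀ {x} → x ∈ₗ ws → x ∈ e′) →
               ws ⊆ₗ blockOf h × blockOf h ⊆ₗ ws
    ws≈block h@(i , j , r , c , lt , mem) h′ e≢e′ ⊆e ⊆e′ =
      ws⊆block ,
      saturate ws-unique (block-unique i r c) ws⊆block (≤-reflexive (trans (length-block i r c) (sym ws-length)))
      where
      ws⊆block : ws ⊆ₗ block i r c
      ws⊆block {x} x∈ with to (mem x) (⊆e x∈)
      ... | inj₁ refl            = ⊥-elim (apex-unshared h h′ e≢e′ (meetTwice ⊆e ⊆e′) (⊆e′ x∈))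
      ... | inj₂ (s , s∈ , refl) = ∈-block⁺ {r = r} s∈

    -- Hence the two edges have the same block, and so the same base.
    sameBase : ∀ {e₁ e₂} (h₁ : H e₁) (h₂ : H e₂) → e₁ ≢ e₂ →
               (∀ {x} → x ∈ₗ ws → x ∈ e₁) → (∀ {x} → x ∈ₗ ws → x ∈ e₂) → base h₁ ≡ base h₂
    sameBase h₁@(i₁ , _ , r₁ , c₁ , _) h₂@(i₂ , _ , r₂ , c₂ , _) e₁≢e₂ ⊆e₁ ⊆e₂
      with ws≈block h₁ h₂ e₁≢e₂ ⊆e₁ ⊆e₂ | ws≈block h₂ h₁ (≢-sym e₁≢e₂) ⊆e₂ ⊆e₁
    ... | ws⊆₁ , ₁⊆ws | ws⊆₂ , ₂⊆ws
      with block-⊆ {i₁} {r₁} {c₁} {i₂} {r₂} {c₂} (ws⊆₂ ∘ ₁⊆ws)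
         | block-⊆ {i₂} {r₂} {c₂} {i₁} {r₁} {c₁} (ws⊆₁ ∘ ₂⊆ws)
    ... | refl , B₁⊆B₂ | _ , B₂⊆B₁ with unique i₁ c₁ i₂ c₂ (⊆-antisym B₁⊆B₂ B₂⊆B₁)
    ... | refl , refl = refl

    -- A pair of vertices in different rows which lies in the union of the two edges lies in
    -- one of them: the edges share their block, and apexes of a common base lie in one row.
    oneEdge : ∀ {e₁ e₂} → H e₁ → H e₂ → e₁ ≢ e₂ →
              (∀ {x} → x ∈ₗ ws → x ∈ e₁) → (∀ {x} → x ∈ₗ ws → x ∈ e₂) →
              ∀ {a b a′ b′} → a <ᶠ a′ → V a b ∈ e₁ ∪ e₂ → V a′ b′ ∈ e₁ ∪ e₂ →
              (V a b ∈ e₁ × V a′ b′ ∈ e₁) ⊎ (V a b ∈ e₂ × V a′ b′ ∈ e₂)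
    oneEdge {e₁} {e₂} h₁ h₂ e₁≢e₂ ⊆e₁ ⊆e₂ a<a′ u∈ v∈ with x∈p∪q⁻ e₁ e₂ u∈ | x∈p∪q⁻ e₁ e₂ v∈
    ... | inj₁ u∈₁ | inj₁ v∈₁ = inj₁ (u∈₁ , v∈₁)
    ... | inj₂ u∈₂ | inj₂ v∈₂ = inj₂ (u∈₂ , v∈₂)
    ... | inj₁ u∈₁ | inj₂ v∈₂ with crossPair h₁ h₂ (sameBase h₁ h₂ e₁≢e₂ ⊆e₁ ⊆e₂) a<a′ u∈₁ v∈₂
    ...   | inj₁ u∈₂ = inj₂ (u∈₂ , v∈₂)
    ...   | inj₂ v∈₁ = inj₁ (u∈₁ , v∈₁)
    oneEdge {e₁} {e₂} h₁ h₂ e₁≢e₂ ⊆e₁ ⊆e₂ a<a′ u∈ v∈ | inj₂ u∈₂ | inj₁ v∈₁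
      with crossPair h₂ h₁ (sameBase h₂ h₁ (≢-sym e₁≢e₂) ⊆e₂ ⊆e₁) a<a′ u∈₂ v∈₁
    ...   | inj₁ u∈₁ = inj₁ (u∈₁ , v∈₁)
    ...   | inj₂ v∈₂ = inj₂ (u∈₂ , v∈₂)

  -- Removing an edge e separates its apex u from any block vertex v: a window sequence of
  -- the remaining edges containing both would contain an edge through u and v, i.e. e.
  separated : ∀ {e i j r c s} → inject₁ i <ᶠ r → (∀ x → x ∈ e ⇔ InEdge i j r c x) → s ∈ B i c →
              ∀ {vs} → WindowSeq k (removeEdge H e) vs → V (inject₁ i) j ∈ₗ vs → V r s ∈ₗ vs → Empty
  separated lt mem s∈ seq u∈ v∈ with toShort seq (noLongSeq proj₁ seq)
  ... | single _ _ (h , e′≢e) = e′≢e (edgeThrough lt mem s∈ h (∈-toSubset⁺ u∈) (∈-toSubset⁺ v∈))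
  ... | double {x} {ws} {y} len (_ ∷ ws-unique) _ (h₁ , w₁≢e) (h₂ , w₂≢e) apart
    with Overlap.oneEdge ws-unique len h₁ h₂ apart (∈-toSubset⁺ ∘ there) (∈-toSubset⁺ ∘ ∈-++⁺ˡ)
                         lt (spread u∈) (spread v∈)
    where
    spread : ∀ {z} → z ∈ₗ x ∷ ws ∷ʳ y → z ∈ toSubset (x ∷ ws) ∪ toSubset (ws ∷ʳ y)
    spread (here refl) = x∈p∪q⁺ (inj₁ (∈-toSubset⁺ {xs = x ∷ ws} (here refl)))
    spread (there z∈)  = x∈p∪q⁺ (inj₂ (∈-toSubset⁺ z∈))
  ... | inj₁ (u∈₁ , v∈₁) = w₁≢e (edgeThrough lt mem s∈ h₁ u∈₁ v∈₁)
  ... | inj₂ (u∈₂ , v∈₂) = w₂≢e (edgeThrough lt mem s∈ h₂ u∈₂ v∈₂)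

  -- Every edge is needed for chain-connectivity: without it, its apex and any of its block
  -- vertices lie on no common chain.
  minimal : ∀ e → H e → ¬ IsHypertree k (removeEdge H e)
  minimal e (i , j , r , c , lt , mem) (_ , chain-connected , _) =
    let s , s∈                  = B-inhabited i c
        u≢v                     = λ u≡v → <⇒≢ lt (sameRow (inject₁ i) j r s u≡v)
        _ , (seq , _) , u∈ , v∈ = chain-connected (V (inject₁ i) j) (V r s) u≢v
    in separated lt mem s∈ seq u∈ v∈

  Linked : Fin N → Fin N → Set
  Linked x y = ∃[ vs ] (IsChain k H vs × x ∈ₗ vs × y ∈ₗ vs)

  edgeChain : ∀ {i j r c} → inject₁ i <ᶠ r → IsChain k H (edgeList i j r c)
  edgeChain {i} {j} {r} {c} lt =
    fromShort (single len (edgeList-unique lt) (edgeList-edge lt)) ,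
    ends-distinct (edgeList-unique lt) (≤-trans (s≤s (s≤s z≤n)) (≤-reflexive (sym len)))
    where
    len : length (edgeList i j r c) ≡ k
    len = cong suc (length-block i r c)

  apexChain : ∀ {i j j′ r c} → inject₁ i <ᶠ r → j ≢ j′ →
              IsChain k H (V (inject₁ i) j ∷ block i r c ∷ʳ V (inject₁ i) j′)
  apexChain {i} {j} {j′} {r} {c} lt j≢j′ =
    fromShort (double (length-block i r c) (edgeList-unique lt) second-unique
                      (edgeList-edge lt) second-edge apart) ,
    ends-distinct all-unique (s≤s (subst (1 ≤_) (sym (length-∷ʳ (block i r c) y)) (s≤s z≤n)))
    where
    x y : Fin N
    x = V (inject₁ i) j
    y = V (inject₁ i) j′
    second-unique : Unique (block i r c ∷ʳ y)
    second-unique = ++⁺ (block-unique i r c) ([] ∷ []) λ { (y∈ , here refl) → ∉-block (<⇒≢ lt) y∈ }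
    x∉second : x ∉ₗ block i r c ∷ʳ y
    x∉second x∈ with ∈-++⁻ (block i r c) x∈
    ... | inj₁ x∈block   = ∉-block (<⇒≢ lt) x∈block
    ... | inj₂ (here x≡y) = j≢j′ (proj₂ (V-injective (inject₁ i) j (inject₁ i) j′ x≡y))
    all-unique : Unique (x ∷ block i r c ∷ʳ y)
    all-unique = All.tabulate (λ z∈ x≡z → x∉second (subst (_∈ₗ block i r c ∷ʳ y) (sym x≡z) z∈)) ∷ second-unique
    second-edge : H (toSubset (block i r c ∷ʳ y))
    second-edge = listedEdge (block i r c ∷ʳ y) lt members listed
      where
      members : ∀ {z} → z ∈ₗ block i r c ∷ʳ y → InEdge i j′ r c z
      members z∈ with ∈-++⁻ (block i r c) z∈
      ... | inj₁ z∈block   = inj₂ (∈-block⁻ {i} {r} {c} z∈block)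
      ... | inj₂ (here z≡y) = inj₁ z≡y
      listed : ∀ {z} → InEdge i j′ r c z → z ∈ₗ block i r c ∷ʳ y
      listed (inj₁ refl)            = ∈-++⁺ʳ (block i r c) (here refl)
      listed (inj₂ (s , s∈ , refl)) = ∈-++⁺ˡ (∈-block⁺ {r = r} s∈)
    apart : Apart (x ∷ block i r c) (block i r c ∷ʳ y)
    apart eq = x∉second (∈-toSubset⁻ (subst (x ∈_) eq (∈-toSubset⁺ {xs = x ∷ block i r c} (here refl))))

  -- Chain-connectivity, which uses m = q·d: then each class B i covers all of Fin m.
  module Connectivity (m≡qd : m ≡ q * d) where

    classCovers : ∀ i b → ∃[ c ] (b ∈ B i c)
    classCovers i = disjointCover (B i) (size i) (disjoint i) m≡qd

    -- There is room for a d-set: m = q·d with q ≥ 1, since Fin m is inhabited.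
    d≤m : Fin m → d ≤ m
    d≤m b = fits q m≡qd (≤-trans (s≤s z≤n) (toℕ<n b))
      where
      fits : ∀ q → m ≡ q * d → 0 < m → d ≤ m
      fits (suc q) refl _ = m≤m+n d (q * d)

    pairSize : ∀ {b b′ : Fin m} → b ≢ b′ → ∣ ⁅ b ⁆ ∪ ⁅ b′ ⁆ ∣ ≡ 2
    pairSize {b} {b′} b≢b′ = trans (∣⁅x⁆∪p∣ (b≢b′ ∘ x∈⁅y⁆⇒x≡y b′)) (cong suc (∣⁅x⁆∣≡1 b′))

    -- Two columns lie in a common d-set, hence in a common block of the factorization.
    commonBlock : ∀ {b b′} → b ≢ b′ → ∃₂ λ i c → b ∈ B i c × b′ ∈ B i c
    commonBlock {b} {b′} b≢b′
      with extend k′ {⁅ b ⁆ ∪ ⁅ b′ ⁆} (subst (λ t → t + k′ ≤ m) (sym (pairSize b≢b′)) (d≤m b))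
    ... | S , pair⊆S , size-S with cover S (trans size-S (cong (_+ k′) (pairSize b≢b′)))
    ... | i , c , B≡S = i , c , subst (b ∈_) (sym B≡S) (pair⊆S (x∈p∪q⁺ (inj₁ (x∈⁅x⁆ b))))
                              , subst (b′ ∈_) (sym B≡S) (pair⊆S (x∈p∪q⁺ (inj₂ (x∈⁅x⁆ b′))))

    below-top : ∀ i → inject₁ i <ᶠ fromℕ l
    below-top i = subst (toℕ (inject₁ i) <_) (sym (toℕ-fromℕ l)) (inject₁ℕ< i)

    -- Vertices in different rows: the upper one is an apex (it is not in the bottom row),
    -- and the lower one lies in a block of the corresponding class.
    acrossRows : ∀ {a a′} b b′ → a <ᶠ a′ → Linked (V a b) (V a′ b′)
    acrossRows {a} {a′} b b′ a<a′ with view a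
    ... | ‵fromℕ     = ⊥-elim (n≮n _ (≤-trans a<a′ (≤fromℕ a′)))
    ... | ‵inject₁ i = let c , b′∈ = classCovers i b′
                       in edgeList i b a′ c , edgeChain a<a′ , here refl , there (∈-block⁺ {r = a′} b′∈)

    -- Vertices in one row: two apexes over a common block, or (in the bottom row) two
    -- vertices of a common block.
    inRow : ∀ a {b b′} → b ≢ b′ → Linked (V a b) (V a b′)
    inRow a {b} {b′} b≢b′ with view a
    ... | ‵inject₁ i = let c , _ = classCovers i b
                       in _ , apexChain {c = c} (below-top i) b≢b′ ,
                          here refl , there (∈-++⁺ʳ (block i (fromℕ l) c) (here refl))
    ... | ‵fromℕ     = let i , c , b∈ , b′∈ = commonBlock b≢b′
                       in edgeList i b (fromℕ l) c , edgeChain (below-top i) ,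
                          there (∈-block⁺ {r = fromℕ l} b∈) , there (∈-block⁺ {r = fromℕ l} b′∈)

    connected : ChainConnected k H
    connected u v u≢v with V-surjective u | V-surjective v
    ... | a , b , refl | a′ , b′ , refl with <-cmp a a′
    ... | tri< a<a′ _ _ = acrossRows b b′ a<a′
    ... | tri> _ _ a′<a = let vs , chain , v∈ , u∈ = acrossRows b′ b a′<a in vs , chain , u∈ , v∈
    ... | tri≈ _ refl _ = inRow a (u≢v ∘ cong (V a))

-- H_m is a 2-hypertree and an edge-minimal hypertree.

lemma7 : (k m q : ℕ) → 3 ≤ k → 0 < m → m ≡ q * (k ∸ 1) →
         (B : Fin (ℓ k m) → Fin q → Subset m) → OneFactorization k m q B →
         Is2Hypertree k (Hm k m q B) × IsEdgeMinimalHypertree k (Hm k m q B)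
lemma7 (suc (suc (suc k′))) m q (s≤s (s≤s (s≤s z≤n))) _ m≡qd B F =
  (hypertree , chainsShort) , (hypertree , minimal)
  where
  open Construction k′ m q B F
  open Connectivity m≡qd
  hypertree : IsHypertree k H
  hypertree = uniform , connected , semicycleFree
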